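{- Let $\mathcal{L}\subseteq\mathbf{Z}^n$ be a lattice of dimension $m$, let $B\in\mathbf{Z}^{n\times m}$ be a matrix whose columns form a basis of $\mathcal{L}$, and let $b_1,\ldots,b_n$ be the rows of $B$. Then $$\mathrm{rad}(V_{\mathcal{L}})=\bigcap_{\sigma}\langle x_i : i\in\sigma\rangle,$$ where the intersection is over all subsets $\sigma\subseteq\{1,\ldots,n\}$ of size $m$ such that $\{b_i: i\in\sigma\}$ is linearly independent.
   Context: $S=k[x_1,\ldots,x_n]$, $x^u=\prod_i x_i^{u_i}$. The dimension of a lattice is its rank. For $u\in\mathbf{N}^n$ the fiber is $P_u=\mathrm{conv}\{v\in\mathbf{N}^n: u-v\in\mathcal{L}\}$; the vertex ideal $V_{\mathcal{L}}$ is the monomial ideal spanned by monomials $x^v$ with $v$ not a vertex of $P_v$. -}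

module Defs where

open import Data.Nat as ℕ using (ℕ; zero; suc)
open import Data.Integer as ℤ using (ℤ; +_)
open import Data.Rational as ℚ using (ℚ; 0ℚ; 1ℚ)
open import Data.Fin using (Fin; zero; suc)
open import Data.Fin.Subset using (Subset; _∈_; _∉_)
open import Data.List using (List; []; _∷_)
open import Data.List.Relation.Unary.All using (All)
open import Data.Product using (Σ; ∃; _×_; _,_; proj₁; proj₂)
open import Relation.Binary.PropositionalEquality using (_≡_)
open import Relation.Nullary using (¬_)

-- Exponent vectors u ∈ ℕ^n (the monomial x^u)
Exp : ℕ → Set
Exp n = Fin n → ℕ

Mat : ℕ → ℕ → Set
Mat n m = Fin n → Fin m → ℤ

Σℤ : ∀ m → (Fin m → ℤ) → ℤ
Σℤ zero    f = + 0
Σℤ (suc m) f = f zero ℤ.+ Σℤ m (λ j → f (suc j))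

Σℚ : ∀ m → (Fin m → ℚ) → ℚ
Σℚ zero    f = 0ℚ
Σℚ (suc m) f = f zero ℚ.+ Σℚ m (λ j → f (suc j))

ℤ→ℚ : ℤ → ℚ
ℤ→ℚ z = z ℚ./ 1

ℕ→ℚ : ℕ → ℚ
ℕ→ℚ k = ℤ→ℚ (+ k)

-- The columns of B are linearly independent (over ℚ); then B is a basis of
-- the lattice it spans, which has dimension m.
ColumnsIndependent : ∀ {n m} → Mat n m → Set
ColumnsIndependent {n} {m} B =
  (c : Fin m → ℚ) →
  (∀ i → Σℚ m (λ j → ℤ→ℚ (B i j) ℚ.* c j) ≡ 0ℚ) →
  ∀ j → c j ≡ 0ℚ

RowsIndependent : ∀ {n m} → Mat n m → Subset n → Set
RowsIndependent {n} {m} B σ =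
  (c : Fin n → ℚ) →
  (∀ i → i ∉ σ → c i ≡ 0ℚ) →
  (∀ j → Σℚ n (λ i → c i ℚ.* ℤ→ℚ (B i j)) ≡ 0ℚ) →
  ∀ i → i ∈ σ → c i ≡ 0ℚ

InLattice : ∀ {n m} → Mat n m → (Fin n → ℤ) → Set
InLattice {n} {m} B z =
  ∃ λ (c : Fin m → ℤ) → ∀ i → z i ≡ Σℤ m (λ j → B i j ℤ.* c j)

InFiber : ∀ {n m} → Mat n m → Exp n → Exp n → Set
InFiber B u w = InLattice B (λ i → + u i ℤ.- + w i)

-- v is NOT a vertex of P_v = conv{ w ∈ ℕ^n : v - w ∈ 𝓛 }:
-- v is a convex combination (rational coefficients) of finitely many
-- points of the fiber different from v.
NotVertex : ∀ {n m} → Mat n m → Exp n → Set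
NotVertex {n} B v =
  Σ (List (ℚ × Exp n)) λ ps →
    All (λ p → (0ℚ ℚ.≤ proj₁ p) × ¬ (∀ i → proj₂ p i ≡ v i) × InFiber B v (proj₂ p)) ps ×
    (sumL (λ p → proj₁ p) ps ≡ 1ℚ) ×
    (∀ i → sumL (λ p → proj₁ p ℚ.* ℕ→ℚ (proj₂ p i)) ps ≡ ℕ→ℚ (v i))
  where
  sumL : (ℚ × Exp n → ℚ) → List (ℚ × Exp n) → ℚ
  sumL f []       = 0ℚ
  sumL f (p ∷ ps) = f p ℚ.+ sumL f ps

-- componentwise order on exponents (x^v divides x^w)
_≤ᵉ_ : ∀ {n} → Exp n → Exp n → Set
v ≤ᵉ w = ∀ i → v i ℕ.≤ w i

-- monomial membership in the vertex ideal V_𝓛: x^w is divisible by some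
-- generator x^v with v not a vertex of P_v
InVertexIdeal : ∀ {n m} → Mat n m → Exp n → Set
InVertexIdeal {n} B w = ∃ λ (v : Exp n) → NotVertex B v × v ≤ᵉ w

-- x^u ∈ rad(I) for a monomial ideal I: (x^u)^k = x^{k u} ∈ I for some k ≥ 1
InRadical : ∀ {n} → (Exp n → Set) → Exp n → Set
InRadical I u = ∃ λ (k : ℕ) → (1 ℕ.≤ k) × I (λ i → k ℕ.* u i)

InPrime : ∀ {n} → Subset n → Exp n → Set
InPrime σ u = ∃ λ i → (i ∈ σ) × (1 ℕ.≤ u i)

-- Let Z be the set of indices i with uᵢ = 0.
--
-- If x^(k u) is divisible by x^v with v a convex combination of other points w
-- of its fiber, then a w of positive weight vanishes wherever v does, in
-- particular on Z; so the lattice vector v - w = B c vanishes on Z. If Z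
-- contained a set σ of m independent rows, the square matrix B_σ would be
-- invertible, forcing c = 0 and w = v. Hence every such σ meets the support of u.
--
-- Conversely, if no m independent rows lie in Z, the rows indexed by Z have rank
-- below m, so some nonzero rational c has (B c)ᵢ = 0 for i ∈ Z. Clearing
-- denominators gives a lattice vector z = B g, nonzero since the columns of B are
-- independent, which vanishes on Z. For k > max |zᵢ| the exponent v = k u
-- satisfies v ± z ≥ 0, and v is the midpoint of the fiber points v + z and v - z,
-- so x^(k u) ∈ V_𝓛.
--
-- Both rank arguments rest on one Gaussian-elimination dichotomy: a set A of
-- columns of a rational matrix either supports a nonzero kernel vector or admits
-- ∣A∣ rows that are independent on A.

module Submission where

open import Defs
open import Data.Nat using (ℕ)
open import Data.Fin.Subset using (Subset; ∣_∣)
open import Relation.Binary.PropositionalEquality using (_≡_)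
open import Function.Bundles using (_⇔_)

open import Algebra.Bundles using (CommutativeRing)
open import Data.Empty using (⊥-elim)
open import Data.Fin using (Fin; zero; suc)
import Data.Fin.Properties as Finₚ
open import Data.Fin.Subset using (_∈_; _∉_; ⊤; ⊥; inside; outside)
open import Data.Fin.Subset.Properties using (_∈?_; ∉⊥; ∣⊥∣≡0; ∣⊤∣≡n; ∣p∣≡n⇒p≡⊤; ∈⊤)
open import Data.Integer as ℤ using (ℤ; -[1+_])
import Data.Integer.Properties as ℤₚ
import Data.Integer.Solver as ℤ-Solver
open import Data.List using (List; []; _∷_)
open import Data.List.Membership.Propositional using () renaming (_∈_ to _∈ₗ_)
open import Data.List.Relation.Unary.All as All using (All; []; _∷_)
open import Data.List.Relation.Unary.Any using (here; there)
import Data.Nat as ℕ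
open import Data.Nat using (zero; suc)
import Data.Nat.Properties as ℕₚ
open import Data.Product using (Σ; ∃; _×_; _,_; proj₁; proj₂)
import Data.Rational as ℚ
open import Data.Rational using (ℚ; 0ℚ; 1ℚ; ½; _+_; _*_; -_; _-_; 1/_; _≤_; mkℚ; ↥_; ↧ₙ_; toℚᵘ)
open import Data.Rational.Literals using (fromℤ)
import Data.Rational.Properties as ℚₚ
open import Data.Rational.Solver using (module +-*-Solver)
import Data.Rational.Unnormalised as ℚᵘ
import Data.Rational.Unnormalised.Properties as ℚᵘₚ
open import Data.Sum using (_⊎_; inj₁; inj₂)
open import Data.Vec using ([]; _∷_; _[_]≔_)
open import Data.Vec.Base using (here; there)
open import Data.Vec.Functional as Vector using (Vector; updateAt)
open import Data.Vec.Functional.Properties using (updateAt-updates; updateAt-minimal)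
open import Function.Base using (_∘_; const)
open import Function.Bundles using (mk⇔; Equivalence)
open import Level using (0ℓ)
open import Relation.Binary.PropositionalEquality
  using (_≢_; refl; sym; trans; cong; cong₂; subst; module ≡-Reasoning)
open import Relation.Nullary using (¬_; Dec; yes; no)
open import Relation.Nullary.Decidable using (decidable-stable; _×-dec_)
open import Relation.Unary using (Pred; Decidable)

open import Algebra.Properties.AbelianGroup ℤₚ.+-0-abelianGroup using (identityʳ-unique)
open import Algebra.Properties.Semiring.Sum (CommutativeRing.semiring ℚₚ.+-*-commutativeRing)
  using (sum; sum-syntax; sum-cong-≗; sum-replicate-zero; *-distribˡ-sum)

p*q≡0⇒p≡0 : ∀ p q → q ≢ 0ℚ → p * q ≡ 0ℚ → p ≡ 0ℚ
p*q≡0⇒p≡0 p q q≢0 pq≡0 = begin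
  p                ≡⟨ sym (ℚₚ.*-identityʳ p) ⟩
  p * 1ℚ           ≡⟨ cong (p *_) (sym (ℚₚ.*-inverseʳ q)) ⟩
  p * (q * 1/ q)   ≡⟨ sym (ℚₚ.*-assoc p q (1/ q)) ⟩
  p * q * 1/ q     ≡⟨ cong (_* 1/ q) pq≡0 ⟩
  0ℚ * 1/ q        ≡⟨ ℚₚ.*-zeroˡ (1/ q) ⟩
  0ℚ               ∎
  where
  open ≡-Reasoning
  instance
    q-nonZero : ℚ.NonZero q
    q-nonZero = ℚ.≢-nonZero q≢0

sum-zero : ∀ {n} {f : Vector ℚ n} → (∀ i → f i ≡ 0ℚ) → sum f ≡ 0ℚ
sum-zero {n} f≡0 = trans (sum-cong-≗ f≡0) (sum-replicate-zero n)

sum-single : ∀ {n} {f : Vector ℚ n} (p : Fin n) → (∀ i → i ≢ p → f i ≡ 0ℚ) → sum f ≡ f p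
sum-single {suc _} {f} zero f≡0 =
  trans (cong (f zero +_) (sum-zero (λ i → f≡0 (suc i) λ ()))) (ℚₚ.+-identityʳ (f zero))
sum-single {suc _} {f} (suc p) f≡0 =
  trans (cong₂ _+_ (f≡0 zero λ ()) (sum-single p λ i i≢p → f≡0 (suc i) (i≢p ∘ Finₚ.suc-injective)))
        (ℚₚ.+-identityˡ (f (suc p)))

∑-linear : ∀ {n} (f g : Vector ℚ n) (c : ℚ) → ∑[ i < n ] (f i - c * g i) ≡ sum f - c * sum g
∑-linear {zero}  f g c = solve 1 (λ c → con 0ℚ := con 0ℚ :- c :* con 0ℚ) refl c
  where open +-*-Solver
∑-linear {suc n} f g c =
  trans (cong (f zero - c * g zero +_) (∑-linear (f ∘ suc) (g ∘ suc) c))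
        (solve 5 (λ c x y s t → (x :- c :* y) :+ (s :- c :* t) := (x :+ s) :- c :* (y :+ t))
               refl c (f zero) (g zero) (sum (f ∘ suc)) (sum (g ∘ suc)))
  where open +-*-Solver

∣p[x]≔inside∣≡1+∣p∣ : ∀ {n} (ρ : Subset n) x → x ∉ ρ → ∣ ρ [ x ]≔ inside ∣ ≡ suc ∣ ρ ∣
∣p[x]≔inside∣≡1+∣p∣ (outside ∷ ρ) zero    _   = refl
∣p[x]≔inside∣≡1+∣p∣ (inside ∷ ρ)  zero    x∉ρ = ⊥-elim (x∉ρ here)
∣p[x]≔inside∣≡1+∣p∣ (outside ∷ ρ) (suc x) x∉ρ = ∣p[x]≔inside∣≡1+∣p∣ ρ x (x∉ρ ∘ there)
∣p[x]≔inside∣≡1+∣p∣ (inside ∷ ρ)  (suc x) x∉ρ = cong suc (∣p[x]≔inside∣≡1+∣p∣ ρ x (x∉ρ ∘ there))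

x∈p[y]≔inside⇒x∈p : ∀ {n} (ρ : Subset n) {x y} → x ≢ y → x ∈ ρ [ y ]≔ inside → x ∈ ρ
x∈p[y]≔inside⇒x∈p (_ ∷ ρ) {zero}  {zero}  x≢y _           = ⊥-elim (x≢y refl)
x∈p[y]≔inside⇒x∈p (_ ∷ ρ) {zero}  {suc y} _   here        = here
x∈p[y]≔inside⇒x∈p (_ ∷ ρ) {suc x} {zero}  _   (there x∈ρ) = there x∈ρ
x∈p[y]≔inside⇒x∈p (_ ∷ ρ) {suc x} {suc y} x≢y (there x∈)  = there (x∈p[y]≔inside⇒x∈p ρ (x≢y ∘ cong suc) x∈)

-- Gaussian elimination

Matrix : ℕ → ℕ → Set
Matrix k N = Fin k → Fin N → ℚ

infixl 7 _*ᵥ_ _ᵥ*_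

_*ᵥ_ : ∀ {k N} → Matrix k N → Vector ℚ N → Vector ℚ k
_*ᵥ_ {N = N} M c i = ∑[ j < N ] (M i j * c j)

_ᵥ*_ : ∀ {k N} → Vector ℚ k → Matrix k N → Vector ℚ N
_ᵥ*_ {k = k} β M j = ∑[ i < k ] (β i * M i j)

transpose : ∀ {k N} → Matrix k N → Matrix N k
transpose M j i = M i j

tailᶜ : ∀ {k N} → Matrix k (suc N) → Matrix k N
tailᶜ M i j = M i (suc j)

SupportedOn : ∀ {n} → Subset n → Vector ℚ n → Set
SupportedOn A c = ∀ j → j ∉ A → c j ≡ 0ℚ

record KernelVector {k N} (M : Matrix k N) (A : Subset N) : Set where
  field
    vector      : Vector ℚ N
    supported   : SupportedOn A vector
    nonzero     : ∃ λ j → j ∈ A × vector j ≢ 0ℚ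
    annihilated : ∀ i → (M *ᵥ vector) i ≡ 0ℚ

IndependentRows : ∀ {k N} → Matrix k N → Subset N → Subset k → Set
IndependentRows M A ρ =
  ∀ β → SupportedOn ρ β → (∀ j → j ∈ A → (β ᵥ* M) j ≡ 0ℚ) → ∀ i → i ∈ ρ → β i ≡ 0ℚ

*ᵥ-zeroʳ : ∀ {k N} (M : Matrix k N) {c : Vector ℚ N} → (∀ j → c j ≡ 0ℚ) → ∀ i → (M *ᵥ c) i ≡ 0ℚ
*ᵥ-zeroʳ M c≡0 i = sum-zero λ j → trans (cong (M i j *_) (c≡0 j)) (ℚₚ.*-zeroʳ (M i j))

*ᵥ-transpose : ∀ {k N} (M : Matrix k N) (β : Vector ℚ k) j → (transpose M *ᵥ β) j ≡ (β ᵥ* M) j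
*ᵥ-transpose M β j = sum-cong-≗ λ i → ℚₚ.*-comm (M i j) (β i)

ᵥ*-zero-row : ∀ {k N} (M : Matrix k N) {p} {β γ : Vector ℚ k} → (∀ j → M p j ≡ 0ℚ) →
              (∀ i → i ≢ p → β i ≡ γ i) → ∀ j → (β ᵥ* M) j ≡ (γ ᵥ* M) j
ᵥ*-zero-row M {p} {β} {γ} M[p]≡0 β≡γ j = sum-cong-≗ term
  where
  term : ∀ i → β i * M i j ≡ γ i * M i j
  term i with i Finₚ.≟ p
  ... | yes refl rewrite M[p]≡0 j = trans (ℚₚ.*-zeroʳ (β p)) (sym (ℚₚ.*-zeroʳ (γ p)))
  ... | no i≢p   = cong (_* M i j) (β≡γ i i≢p)

zero-row∉IndependentRows : ∀ {k N} (M : Matrix k N) {A ρ p} → (∀ j → M p j ≡ 0ℚ) →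
                           IndependentRows M A ρ → p ∉ ρ
zero-row∉IndependentRows {k} M {A} {ρ} {p} M[p]≡0 ind p∈ρ =
  ℚₚ.1≢0 (trans (sym (updateAt-updates p (const 0ℚ))) (ind eₚ supported eₚM≡0 p p∈ρ))
  where
  eₚ : Vector ℚ k
  eₚ = updateAt (const 0ℚ) p (const 1ℚ)
  eₚ≡0 : ∀ i → i ≢ p → eₚ i ≡ 0ℚ
  eₚ≡0 i i≢p = updateAt-minimal i p (const 0ℚ) i≢p
  supported : SupportedOn ρ eₚ
  supported i i∉ρ = eₚ≡0 i λ { refl → i∉ρ p∈ρ }
  eₚM≡0 : ∀ j → j ∈ A → (eₚ ᵥ* M) j ≡ 0ℚ
  eₚM≡0 j _ = trans (ᵥ*-zero-row M M[p]≡0 eₚ≡0 j) (sum-zero λ i → ℚₚ.*-zeroˡ (M i j))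

-- The columns A of M have rank below ∣A∣ (a kernel vector supported on A) or
-- equal to ∣A∣ (∣A∣ rows independent on A).
RankDichotomy : ∀ {k N} → Matrix k N → Subset N → Set
RankDichotomy M A = KernelVector M A ⊎ ∃ λ ρ → ∣ ρ ∣ ≡ ∣ A ∣ × IndependentRows M A ρ

module _ {k N} {M : Matrix k (suc N)} {A : Subset N} where

  KernelVector-extend : ∀ s → KernelVector (tailᶜ M) A → KernelVector M (s ∷ A)
  KernelVector-extend s kv = record
    { vector      = 0ℚ Vector.∷ vector
    ; supported   = λ { zero _ → refl ; (suc j) j∉ → supported j (j∉ ∘ there) }
    ; nonzero     = let (j , j∈A , cⱼ≢0) = nonzero in suc j , there j∈A , cⱼ≢0
    ; annihilated = λ i → trans (cong₂ _+_ (ℚₚ.*-zeroʳ (M i zero)) (annihilated i)) (ℚₚ.+-identityˡ 0ℚ)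
    }
    where open KernelVector kv

  IndependentRows-extend : ∀ s {ρ} → IndependentRows (tailᶜ M) A ρ → IndependentRows M (s ∷ A) ρ
  IndependentRows-extend s ind β supported βM≡0 = ind β supported λ j j∈A → βM≡0 (suc j) (there j∈A)

  zero-column⇒KernelVector : (∀ i → M i zero ≡ 0ℚ) → KernelVector M (inside ∷ A)
  zero-column⇒KernelVector column≡0 = record
    { vector      = 1ℚ Vector.∷ const 0ℚ
    ; supported   = λ { zero 0∉ → ⊥-elim (0∉ here) ; (suc j) _ → refl }
    ; nonzero     = zero , here , ℚₚ.1≢0
    ; annihilated = λ i → trans (cong₂ _+_ (trans (cong (_* 1ℚ) (column≡0 i)) (ℚₚ.*-zeroˡ 1ℚ))
                                          (*ᵥ-zeroʳ (tailᶜ M) (λ _ → refl) i))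
                                (ℚₚ.+-identityˡ 0ℚ)
    }

-- One step of Gaussian elimination: clear column 0 using the pivot row p.
module Pivot {k N} (M : Matrix k (suc N)) (p : Fin k) (M[p,0]≢0 : M p zero ≢ 0ℚ) where

  private instance
    pivot-nonZero : ℚ.NonZero (M p zero)
    pivot-nonZero = ℚ.≢-nonZero M[p,0]≢0

  multiplier : Vector ℚ k
  multiplier i = M i zero * 1/ M p zero

  eliminated : Matrix k N
  eliminated i j = M i (suc j) - multiplier i * M p (suc j)

  eliminated-pivot-row : ∀ j → eliminated p j ≡ 0ℚ
  eliminated-pivot-row j = begin
    M p (suc j) - M p zero * 1/ M p zero * M p (suc j)
      ≡⟨ cong (λ r → M p (suc j) - r * M p (suc j)) (ℚₚ.*-inverseʳ (M p zero)) ⟩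
    M p (suc j) - 1ℚ * M p (suc j)
      ≡⟨ solve 1 (λ x → x :- con 1ℚ :* x := con 0ℚ) refl (M p (suc j)) ⟩
    0ℚ ∎
    where
    open ≡-Reasoning
    open +-*-Solver

  *ᵥ-eliminated : ∀ c i → (eliminated *ᵥ c) i ≡ (tailᶜ M *ᵥ c) i - multiplier i * (tailᶜ M *ᵥ c) p
  *ᵥ-eliminated c i = trans (sum-cong-≗ λ j → distrib (M i (suc j)) (multiplier i) (M p (suc j)) (c j))
                            (∑-linear (λ j → M i (suc j) * c j) (λ j → M p (suc j) * c j) (multiplier i))
    where
    open +-*-Solver
    distrib : ∀ x r y z → (x - r * y) * z ≡ x * z - r * (y * z)
    distrib = solve 4 (λ x r y z → (x :- r :* y) :* z := x :* z :- r :* (y :* z)) refl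

  ᵥ*-eliminated : ∀ β j → (β ᵥ* eliminated) j ≡ (β ᵥ* M) (suc j) - (1/ M p zero * M p (suc j)) * (β ᵥ* M) zero
  ᵥ*-eliminated β j = trans (sum-cong-≗ λ i → distrib (β i) (M i (suc j)) (M i zero) (1/ M p zero) (M p (suc j)))
                            (∑-linear (λ i → β i * M i (suc j)) (λ i → β i * M i zero) (1/ M p zero * M p (suc j)))
    where
    open +-*-Solver
    distrib : ∀ b x m v y → b * (x - m * v * y) ≡ b * x - v * y * (b * m)
    distrib = solve 5 (λ b x m v y → b :* (x :- m :* v :* y) := b :* x :- v :* y :* (b :* m)) refl

  KernelVector-lift : ∀ {A} → KernelVector eliminated A → KernelVector M (inside ∷ A)
  KernelVector-lift kv = record
    { vector      = c₀ Vector.∷ vector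
    ; supported   = λ { zero 0∉ → ⊥-elim (0∉ here) ; (suc j) j∉ → supported j (j∉ ∘ there) }
    ; nonzero     = let (j , j∈A , cⱼ≢0) = nonzero in suc j , there j∈A , cⱼ≢0
    ; annihilated = λ i → trans (back-substitute i) (trans (sym (*ᵥ-eliminated vector i)) (annihilated i))
    }
    where
    open KernelVector kv
    S : Vector ℚ k
    S = tailᶜ M *ᵥ vector
    c₀ : ℚ
    c₀ = - (1/ M p zero * S p)
    back-substitute : ∀ i → M i zero * c₀ + S i ≡ S i - multiplier i * S p
    back-substitute i = solve 4 (λ m v s t → m :* (:- (v :* s)) :+ t := t :- m :* v :* s) refl
                                (M i zero) (1/ M p zero) (S p) (S i)
      where open +-*-Solver

  vanishes-off-pivot : ∀ {A ρ} → IndependentRows eliminated A ρ → ∀ {β} → SupportedOn (ρ [ p ]≔ inside) β →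
                       (∀ j → j ∈ inside ∷ A → (β ᵥ* M) j ≡ 0ℚ) → ∀ i → i ≢ p → β i ≡ 0ℚ
  vanishes-off-pivot {A} {ρ} ind {β} supported βM≡0 i i≢p with i ∈? ρ
  ... | yes i∈ρ = trans (sym (updateAt-minimal i p β i≢p)) (ind β′ β′-supported β′E≡0 i i∈ρ)
    where
    β′ : Vector ℚ k
    β′ = updateAt β p (const 0ℚ)
    β′-supported : SupportedOn ρ β′
    β′-supported j j∉ρ with j Finₚ.≟ p
    ... | yes refl = updateAt-updates p β
    ... | no j≢p   = trans (updateAt-minimal j p β j≢p) (supported j (j∉ρ ∘ x∈p[y]≔inside⇒x∈p ρ j≢p))
    β′E≡0 : ∀ j → j ∈ A → (β′ ᵥ* eliminated) j ≡ 0ℚ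
    β′E≡0 j j∈A = begin
      (β′ ᵥ* eliminated) j ≡⟨ ᵥ*-zero-row eliminated eliminated-pivot-row (λ i i≢p → updateAt-minimal i p β i≢p) j ⟩
      (β ᵥ* eliminated) j  ≡⟨ ᵥ*-eliminated β j ⟩
      (β ᵥ* M) (suc j) - r * (β ᵥ* M) zero ≡⟨ cong₂ (λ x y → x - r * y) (βM≡0 (suc j) (there j∈A)) (βM≡0 zero here) ⟩
      0ℚ - r * 0ℚ                          ≡⟨ solve 1 (λ x → con 0ℚ :- x :* con 0ℚ := con 0ℚ) refl r ⟩
      0ℚ                                   ∎
      where
      r : ℚ
      r = 1/ M p zero * M p (suc j)
      open ≡-Reasoning
      open +-*-Solver
  ... | no  i∉ρ = supported i (i∉ρ ∘ x∈p[y]≔inside⇒x∈p ρ i≢p)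

  IndependentRows-lift : ∀ {A ρ} → IndependentRows eliminated A ρ →
                         IndependentRows M (inside ∷ A) (ρ [ p ]≔ inside)
  IndependentRows-lift ind β supported βM≡0 i _ with i Finₚ.≟ p
  ... | no i≢p   = vanishes-off-pivot ind supported βM≡0 i i≢p
  ... | yes refl = p*q≡0⇒p≡0 (β p) (M p zero) M[p,0]≢0 (begin
    β p * M p zero   ≡⟨ sum-single p other-terms≡0 ⟨
    (β ᵥ* M) zero    ≡⟨ βM≡0 zero here ⟩
    0ℚ               ∎)
    where
    open ≡-Reasoning
    other-terms≡0 : ∀ i → i ≢ p → β i * M i zero ≡ 0ℚ
    other-terms≡0 i i≢p =
      trans (cong (_* M i zero) (vanishes-off-pivot ind supported βM≡0 i i≢p)) (ℚₚ.*-zeroˡ (M i zero))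

  lift : ∀ {A} → RankDichotomy eliminated A → RankDichotomy M (inside ∷ A)
  lift (inj₁ kv) = inj₁ (KernelVector-lift kv)
  lift {A} (inj₂ (ρ , ∣ρ∣≡∣A∣ , ind)) = inj₂ (ρ [ p ]≔ inside , ∣ρ+p∣≡1+∣A∣ , IndependentRows-lift ind)
    where
    ∣ρ+p∣≡1+∣A∣ : ∣ ρ [ p ]≔ inside ∣ ≡ suc ∣ A ∣
    ∣ρ+p∣≡1+∣A∣ = trans (∣p[x]≔inside∣≡1+∣p∣ ρ p (zero-row∉IndependentRows eliminated eliminated-pivot-row ind))
                        (cong suc ∣ρ∣≡∣A∣)

rank-dichotomy : ∀ {k N} (M : Matrix k N) (A : Subset N) → RankDichotomy M A
rank-dichotomy {k} {zero} M [] = inj₂ (⊥ , ∣⊥∣≡0 k , λ _ _ _ _ i∈⊥ → ⊥-elim (∉⊥ i∈⊥))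
rank-dichotomy {N = suc N} M (outside ∷ A) with rank-dichotomy (tailᶜ M) A
... | inj₁ kv                   = inj₁ (KernelVector-extend outside kv)
... | inj₂ (ρ , ∣ρ∣≡∣A∣ , ind) = inj₂ (ρ , ∣ρ∣≡∣A∣ , IndependentRows-extend outside ind)
rank-dichotomy {k} {suc N} M (inside ∷ A) with Finₚ.all? (λ i → M i zero ℚₚ.≟ 0ℚ)
... | yes column≡0 = inj₁ (zero-column⇒KernelVector column≡0)
... | no  column≢0 =
  let (p , M[p,0]≢0) = Finₚ.¬∀⟶∃¬ k _ (λ i → M i zero ℚₚ.≟ 0ℚ) column≢0
  in Pivot.lift M p M[p,0]≢0 (rank-dichotomy (Pivot.eliminated M p M[p,0]≢0) A)

-- Row rank equals column rank: the dichotomy for the transpose on the columns σ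
-- can only produce m independent rows, that is, all of them.
square-IndependentRows⇒*ᵥ-injective : ∀ {n m} (M : Matrix n m) {σ} → ∣ σ ∣ ≡ m → IndependentRows M ⊤ σ →
                                     ∀ c → (∀ i → i ∈ σ → (M *ᵥ c) i ≡ 0ℚ) → ∀ j → c j ≡ 0ℚ
square-IndependentRows⇒*ᵥ-injective M {σ} ∣σ∣≡m ind c Mc≡0 with rank-dichotomy (transpose M) σ
... | inj₁ kv = let (i , i∈σ , αᵢ≢0) = nonzero in ⊥-elim (αᵢ≢0 (ind α supported αM≡0 i i∈σ))
  where
  open KernelVector kv renaming (vector to α)
  αM≡0 : ∀ j → j ∈ ⊤ → (α ᵥ* M) j ≡ 0ℚ
  αM≡0 j _ = trans (sym (*ᵥ-transpose M α j)) (annihilated j)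
... | inj₂ (ρ , ∣ρ∣≡∣σ∣ , indᵀ) = λ j → indᵀ c (λ j j∉ρ → ⊥-elim (j∉ρ (∈ρ j))) cMᵀ≡0 j (∈ρ j)
  where
  ∈ρ : ∀ j → j ∈ ρ
  ∈ρ j = subst (j ∈_) (sym (∣p∣≡n⇒p≡⊤ (trans ∣ρ∣≡∣σ∣ ∣σ∣≡m))) ∈⊤
  cMᵀ≡0 : ∀ i → i ∈ σ → (c ᵥ* transpose M) i ≡ 0ℚ
  cMᵀ≡0 i i∈σ = trans (sym (*ᵥ-transpose (transpose M) c i)) (Mc≡0 i i∈σ)

module _ {n m} {P : Pred (Fin n) 0ℓ} (P? : Decidable P) (M : Matrix n m) where

  restrictRows : Matrix n m
  restrictRows i j with P? i
  ... | yes _ = M i j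
  ... | no  _ = 0ℚ

  restrictRows-∈ : ∀ {i} → P i → ∀ j → restrictRows i j ≡ M i j
  restrictRows-∈ {i} Pi j with P? i
  ... | yes _  = refl
  ... | no ¬Pi = ⊥-elim (¬Pi Pi)

  restrictRows-∉ : ∀ {i} → ¬ P i → ∀ j → restrictRows i j ≡ 0ℚ
  restrictRows-∉ {i} ¬Pi j with P? i
  ... | yes Pi = ⊥-elim (¬Pi Pi)
  ... | no _   = refl

  kernel-or-independent-rows-within :
    (∃ λ c → (∃ λ j → c j ≢ 0ℚ) × ∀ i → P i → (M *ᵥ c) i ≡ 0ℚ) ⊎
    (∃ λ σ → ∣ σ ∣ ≡ m × IndependentRows M ⊤ σ × ∀ i → i ∈ σ → P i)
  kernel-or-independent-rows-within with rank-dichotomy restrictRows ⊤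
  ... | inj₁ kv = let (j , _ , cⱼ≢0) = nonzero in inj₁ (vector , (j , cⱼ≢0) , Mc≡0)
    where
    open KernelVector kv
    Mc≡0 : ∀ i → P i → (M *ᵥ vector) i ≡ 0ℚ
    Mc≡0 i Pi = trans (sum-cong-≗ λ j → cong (_* vector j) (sym (restrictRows-∈ Pi j))) (annihilated i)
  ... | inj₂ (σ , ∣σ∣≡∣⊤∣ , ind) = inj₂ (σ , trans ∣σ∣≡∣⊤∣ (∣⊤∣≡n m) , ind′ , σ⊆P)
    where
    σ⊆P : ∀ i → i ∈ σ → P i
    σ⊆P i i∈σ = decidable-stable (P? i) λ ¬Pi → zero-row∉IndependentRows restrictRows (restrictRows-∉ ¬Pi) ind i∈σ
    ind′ : IndependentRows M ⊤ σ
    ind′ β supported βM≡0 = ind β supported λ j j∈⊤ → trans (sum-cong-≗ (term j)) (βM≡0 j j∈⊤)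
      where
      term : ∀ j i → β i * restrictRows i j ≡ β i * M i j
      term j i with i ∈? σ
      ... | yes i∈σ = cong (β i *_) (restrictRows-∈ (σ⊆P i i∈σ) j)
      ... | no  i∉σ = trans (βᵢ*-≡0 (restrictRows i j)) (sym (βᵢ*-≡0 (M i j)))
        where
        βᵢ*-≡0 : ∀ x → β i * x ≡ 0ℚ
        βᵢ*-≡0 x = trans (cong (_* x) (supported i i∉σ)) (ℚₚ.*-zeroˡ x)

-- ℤ→ℚ z = z / 1 normalises to fromℤ z, on which _+_ and _*_ of ℚ compute.
ℤ→ℚ≡fromℤ : ∀ z → ℤ→ℚ z ≡ fromℤ z
ℤ→ℚ≡fromℤ z = ℚₚ.↥p/↧p≡p (fromℤ z)

ℤ→ℚ-injective : ∀ {a b} → ℤ→ℚ a ≡ ℤ→ℚ b → a ≡ b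
ℤ→ℚ-injective {a} {b} eq = cong ↥_ (trans (sym (ℤ→ℚ≡fromℤ a)) (trans eq (ℤ→ℚ≡fromℤ b)))

ℕ→ℚ-injective : ∀ {a b} → ℕ→ℚ a ≡ ℕ→ℚ b → a ≡ b
ℕ→ℚ-injective = ℤₚ.+-injective ∘ ℤ→ℚ-injective

p*ℕ→ℚ-nonNeg : ∀ {p} → 0ℚ ≤ p → ∀ k → 0ℚ ≤ p * ℕ→ℚ k
p*ℕ→ℚ-nonNeg {p} 0≤p k = ℚₚ.nonNegative⁻¹ (p * ℕ→ℚ k)
  {{ℚₚ.nonNeg*nonNeg⇒nonNeg p {{ℚ.nonNegative 0≤p}} (ℕ→ℚ k) {{ℚₚ.normalize-nonNeg k 1}}}}

ℤ→ℚ-+ : ∀ a b → ℤ→ℚ (a ℤ.+ b) ≡ ℤ→ℚ a + ℤ→ℚ b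
ℤ→ℚ-+ a b = begin
  ℤ→ℚ (a ℤ.+ b)                     ≡⟨ cong ℤ→ℚ (cong₂ ℤ._+_ (ℤₚ.*-identityʳ a) (ℤₚ.*-identityʳ b)) ⟨
  ℤ→ℚ (a ℤ.* ℤ.+ 1 ℤ.+ b ℤ.* ℤ.+ 1)     ≡⟨⟩
  fromℤ a + fromℤ b                 ≡⟨ cong₂ _+_ (ℤ→ℚ≡fromℤ a) (ℤ→ℚ≡fromℤ b) ⟨
  ℤ→ℚ a + ℤ→ℚ b                     ∎
  where open ≡-Reasoning

ℤ→ℚ-* : ∀ a b → ℤ→ℚ (a ℤ.* b) ≡ ℤ→ℚ a * ℤ→ℚ b
ℤ→ℚ-* a b = sym (cong₂ _*_ (ℤ→ℚ≡fromℤ a) (ℤ→ℚ≡fromℤ b))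

ℕ→ℚ-* : ∀ a b → ℕ→ℚ (a ℕ.* b) ≡ ℕ→ℚ a * ℕ→ℚ b
ℕ→ℚ-* a b = trans (cong ℤ→ℚ (ℤₚ.pos-* a b)) (ℤ→ℚ-* (ℤ.+ a) (ℤ.+ b))

ℤ→ℚ-neg : ∀ a → ℤ→ℚ (ℤ.- a) ≡ - ℤ→ℚ a
ℤ→ℚ-neg a = trans (ℤ→ℚ≡fromℤ (ℤ.- a)) (trans (fromℤ-neg a) (cong -_ (sym (ℤ→ℚ≡fromℤ a))))
  where
  fromℤ-neg : ∀ a → fromℤ (ℤ.- a) ≡ - fromℤ a
  fromℤ-neg (ℤ.+ 0)    = refl
  fromℤ-neg ℤ.+[1+ _ ] = refl
  fromℤ-neg -[1+ _ ]   = refl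

ℤ→ℚ-Σℤ : ∀ m (f : Fin m → ℤ) → ℤ→ℚ (Σℤ m f) ≡ ∑[ j < m ] ℤ→ℚ (f j)
ℤ→ℚ-Σℤ zero    f = refl
ℤ→ℚ-Σℤ (suc m) f = trans (ℤ→ℚ-+ (f zero) _) (cong (ℤ→ℚ (f zero) +_) (ℤ→ℚ-Σℤ m (f ∘ suc)))

ℤ→ℚ-↥ : ∀ p → ℤ→ℚ (↥ p) ≡ ℕ→ℚ (↧ₙ p) * p
ℤ→ℚ-↥ p@(mkℚ n d _) = ℚₚ.toℚᵘ-injective (begin
  toℚᵘ (ℤ→ℚ n)                        ≡⟨ cong toℚᵘ (ℤ→ℚ≡fromℤ n) ⟩
  ℚᵘ.mkℚᵘ n 0                         ≈⟨ ℚᵘ.*≡* (cross-multiply n (ℤ.+ suc d)) ⟩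
  ℚᵘ.mkℚᵘ (ℤ.+ suc d) 0 ℚᵘ.* toℚᵘ p   ≡⟨ cong (λ q → toℚᵘ q ℚᵘ.* toℚᵘ p) (ℤ→ℚ≡fromℤ (ℤ.+ suc d)) ⟨
  toℚᵘ (ℕ→ℚ (suc d)) ℚᵘ.* toℚᵘ p      ≈⟨ ℚₚ.toℚᵘ-homo-* (ℕ→ℚ (suc d)) p ⟨
  toℚᵘ (ℕ→ℚ (suc d) * p)              ∎)
  where
  open ℚᵘₚ.≃-Reasoning
  cross-multiply : ∀ x y → x ℤ.* (ℤ.+ 1 ℤ.* y) ≡ (y ℤ.* x) ℤ.* ℤ.+ 1
  cross-multiply = solve 2 (λ x y → x :* (con (ℤ.+ 1) :* y) := (y :* x) :* con (ℤ.+ 1)) refl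
    where open ℤ-Solver.+-*-Solver

common-denominator : ∀ m (c : Vector ℚ m) →
                     ∃ λ d → d ≢ 0 × ∃ λ (g : Fin m → ℤ) → ∀ j → ℤ→ℚ (g j) ≡ ℕ→ℚ d * c j
common-denominator zero    c = 1 , (λ ()) , (λ ()) , (λ ())
common-denominator (suc m) c with common-denominator m (c ∘ suc)
... | d , d≢0 , g , g≡dc = d ℕ.* e , de≢0 , g′ , g′≡dec
  where
  e : ℕ
  e = ↧ₙ (c zero)
  de≢0 : d ℕ.* e ≢ 0
  de≢0 de≡0 with ℕₚ.m*n≡0⇒m≡0∨n≡0 d de≡0
  ... | inj₁ d≡0 = d≢0 d≡0
  ... | inj₂ ()
  g′ : Fin (suc m) → ℤ
  g′ zero    = ↥ (c zero) ℤ.* ℤ.+ d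
  g′ (suc j) = g j ℤ.* ℤ.+ e
  open +-*-Solver
  g′≡dec : ∀ j → ℤ→ℚ (g′ j) ≡ ℕ→ℚ (d ℕ.* e) * c j
  g′≡dec zero rewrite ℤ→ℚ-* (↥ (c zero)) (ℤ.+ d) | ℤ→ℚ-↥ (c zero) | ℕ→ℚ-* d e =
    solve 3 (λ x y z → (y :* z) :* x := (x :* y) :* z) refl (ℕ→ℚ d) (ℕ→ℚ e) (c zero)
  g′≡dec (suc j) rewrite ℤ→ℚ-* (g j) (ℤ.+ e) | g≡dc j | ℕ→ℚ-* d e =
    solve 3 (λ x y z → (x :* z) :* y := (x :* y) :* z) refl (ℕ→ℚ d) (ℕ→ℚ e) (c (suc j))

toℚ : ∀ {n m} → Mat n m → Matrix n m
toℚ B i j = ℤ→ℚ (B i j)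

Σℚ≡sum : ∀ m (f : Vector ℚ m) → Σℚ m f ≡ sum f
Σℚ≡sum zero    f = refl
Σℚ≡sum (suc m) f = cong (f zero +_) (Σℚ≡sum m (f ∘ suc))

RowsIndependent⇔IndependentRows : ∀ {n m} (B : Mat n m) (σ : Subset n) →
                                  RowsIndependent B σ ⇔ IndependentRows (toℚ B) ⊤ σ
RowsIndependent⇔IndependentRows {n} B σ = mk⇔
  (λ ind β supported βB≡0 → ind β supported λ j → trans (Σℚ≡sum n _) (βB≡0 j ∈⊤))
  (λ ind β supported βB≡0 → ind β supported λ j _ → trans (sym (Σℚ≡sum n _)) (βB≡0 j))

ColumnsIndependent⇒image≢0 : ∀ {n m} (B : Mat n m) → ColumnsIndependent B →
                             ∀ c → (∃ λ j → c j ≢ 0ℚ) → ∃ λ i → (toℚ B *ᵥ c) i ≢ 0ℚ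
ColumnsIndependent⇒image≢0 {n} {m} B independent c (j , cⱼ≢0) =
  Finₚ.¬∀⟶∃¬ n _ (λ i → (toℚ B *ᵥ c) i ℚₚ.≟ 0ℚ)
    λ Bc≡0 → cⱼ≢0 (independent c (λ i → trans (Σℚ≡sum m _) (Bc≡0 i)) j)

ℤ→ℚ-*ᵥ : ∀ {n m} (B : Mat n m) (g : Fin m → ℤ) i →
          ℤ→ℚ (Σℤ m (λ j → B i j ℤ.* g j)) ≡ (toℚ B *ᵥ (ℤ→ℚ ∘ g)) i
ℤ→ℚ-*ᵥ {m = m} B g i = trans (ℤ→ℚ-Σℤ m _) (sum-cong-≗ λ j → ℤ→ℚ-* (B i j) (g j))

lattice-multiple : ∀ {n m} (B : Mat n m) (c : Vector ℚ m) →
                   ∃ λ d → d ≢ 0 × ∃ λ z → InLattice B z × ∀ i → ℤ→ℚ (z i) ≡ ℕ→ℚ d * (toℚ B *ᵥ c) i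
lattice-multiple {m = m} B c =
  let (d , d≢0 , g , g≡dc) = common-denominator m c
  in d , d≢0 , (λ i → Σℤ m (λ j → B i j ℤ.* g j)) , (g , λ _ → refl) , λ i → begin
    ℤ→ℚ (Σℤ m (λ j → B i j ℤ.* g j))     ≡⟨ ℤ→ℚ-*ᵥ B g i ⟩
    ∑[ j < m ] (toℚ B i j * ℤ→ℚ (g j))   ≡⟨ sum-cong-≗ (λ j → trans (cong (toℚ B i j *_) (g≡dc j))
                                                                    (swap (toℚ B i j) (ℕ→ℚ d) (c j))) ⟩
    ∑[ j < m ] (ℕ→ℚ d * (toℚ B i j * c j)) ≡⟨ *-distribˡ-sum (ℕ→ℚ d) (λ j → toℚ B i j * c j) ⟨
    ℕ→ℚ d * (toℚ B *ᵥ c) i              ∎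
  where
  open ≡-Reasoning
  swap : ∀ x y z → x * (y * z) ≡ y * (x * z)
  swap = solve 3 (λ x y z → x :* (y :* z) := y :* (x :* z)) refl
    where open +-*-Solver

nonzero-lattice-multiple : ∀ {n m} (B : Mat n m) → ColumnsIndependent B → ∀ c → (∃ λ j → c j ≢ 0ℚ) →
                           ∃ λ z → InLattice B z × (∃ λ i → z i ≢ ℤ.+ 0) ×
                                   (∀ i → (toℚ B *ᵥ c) i ≡ 0ℚ → z i ≡ ℤ.+ 0)
nonzero-lattice-multiple B independent c c≢0 =
  let (d , d≢0 , z , z∈𝓛 , z≡dBc) = lattice-multiple B c
      (i , Bcᵢ≢0) = ColumnsIndependent⇒image≢0 B independent c c≢0
      d≢0ℚ = d≢0 ∘ ℕ→ℚ-injective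
  in z , z∈𝓛 , (i , λ zᵢ≡0 → Bcᵢ≢0 (p*q≡0⇒p≡0 _ (ℕ→ℚ d) d≢0ℚ
                                   (trans (ℚₚ.*-comm _ (ℕ→ℚ d)) (trans (sym (z≡dBc i)) (cong ℤ→ℚ zᵢ≡0)))))
   , λ i Bcᵢ≡0 → ℤ→ℚ-injective (trans (z≡dBc i) (trans (cong (ℕ→ℚ d *_) Bcᵢ≡0) (ℚₚ.*-zeroʳ (ℕ→ℚ d))))

Σℤ-*-neg : ∀ m (f g : Fin m → ℤ) → Σℤ m (λ j → f j ℤ.* ℤ.- g j) ≡ ℤ.- Σℤ m (λ j → f j ℤ.* g j)
Σℤ-*-neg zero    f g = refl
Σℤ-*-neg (suc m) f g rewrite Σℤ-*-neg m (f ∘ suc) (g ∘ suc) =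
  solve 3 (λ a b s → a :* (:- b) :+ (:- s) := :- (a :* b :+ s)) refl
          (f zero) (g zero) (Σℤ m (λ j → f (suc j) ℤ.* g (suc j)))
  where open ℤ-Solver.+-*-Solver

InLattice-neg : ∀ {n m} (B : Mat n m) {z} → InLattice B z → InLattice B (λ i → ℤ.- z i)
InLattice-neg {m = m} B (c , z≡Bc) =
  (λ j → ℤ.- c j) , λ i → trans (cong (λ t → ℤ.- t) (z≡Bc i)) (sym (Σℤ-*-neg m (B i) c))

InLattice⇒InFiber : ∀ {n m} (B : Mat n m) {x v w} → InLattice B x →
                    (∀ i → ℤ.+ w i ≡ ℤ.+ v i ℤ.+ x i) → InFiber B v w
InLattice⇒InFiber B {x} {v} x∈𝓛 w≡v+x =
  let (c , -x≡Bc) = InLattice-neg B x∈𝓛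
  in c , λ i → trans (cong (λ t → ℤ.+ v i ℤ.- t) (w≡v+x i)) (trans (v-[v+x]≡-x (ℤ.+ v i) (x i)) (-x≡Bc i))
  where
  v-[v+x]≡-x : ∀ v x → v ℤ.- (v ℤ.+ x) ≡ ℤ.- x
  v-[v+x]≡-x = solve 2 (λ v x → v :- (v :+ x) := :- x) refl
    where open ℤ-Solver.+-*-Solver

-- Non-vertices from lattice vectors

natural-offset : ∀ v x → ℤ.∣ x ∣ ℕ.≤ v → ∃ λ w → ℤ.+ w ≡ ℤ.+ v ℤ.+ x
natural-offset v (ℤ.+ b)  _   = v ℕ.+ b , sym (ℤₚ.pos-+ v b)
natural-offset v -[1+ b ] b<v = v ℕ.∸ suc b , sym (ℤₚ.⊖-≥ b<v)

lattice-offset∈fiber : ∀ {n m} (B : Mat n m) {v : Exp n} {x} → InLattice B x → (∃ λ i → x i ≢ ℤ.+ 0) →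
                       (∀ i → ℤ.∣ x i ∣ ℕ.≤ v i) →
                       ∃ λ w → ¬ (∀ i → w i ≡ v i) × InFiber B v w × ∀ i → ℕ→ℚ (w i) ≡ ℕ→ℚ (v i) + ℤ→ℚ (x i)
lattice-offset∈fiber {n} B {v} {x} x∈𝓛 (i₀ , xᵢ₀≢0) ∣x∣≤v =
  w , w≢v , InLattice⇒InFiber B x∈𝓛 w≡v+x , λ i → trans (cong ℤ→ℚ (w≡v+x i)) (ℤ→ℚ-+ (ℤ.+ v i) (x i))
  where
  w : Exp n
  w i = proj₁ (natural-offset (v i) (x i) (∣x∣≤v i))
  w≡v+x : ∀ i → ℤ.+ w i ≡ ℤ.+ v i ℤ.+ x i
  w≡v+x i = proj₂ (natural-offset (v i) (x i) (∣x∣≤v i))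
  w≢v : ¬ (∀ i → w i ≡ v i)
  w≢v w≡v = xᵢ₀≢0 (identityʳ-unique (ℤ.+ v i₀) (x i₀) (trans (sym (w≡v+x i₀)) (cong (λ k → ℤ.+ k) (w≡v i₀))))

-- v is the midpoint of the fiber points v + z and v - z.
midpoint⇒NotVertex : ∀ {n m} (B : Mat n m) {v : Exp n} {z} → InLattice B z → (∃ λ i → z i ≢ ℤ.+ 0) →
                     (∀ i → ℤ.∣ z i ∣ ℕ.≤ v i) → NotVertex B v
midpoint⇒NotVertex B {v} {z} z∈𝓛 (i₀ , zᵢ₀≢0) ∣z∣≤v =
  let (w₊ , w₊≢v , w₊∈fiber , w₊≡v+z) = lattice-offset∈fiber B z∈𝓛 (i₀ , zᵢ₀≢0) ∣z∣≤v
      (w₋ , w₋≢v , w₋∈fiber , w₋≡v-z) =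
        lattice-offset∈fiber B (InLattice-neg B z∈𝓛) (i₀ , zᵢ₀≢0 ∘ ℤₚ.neg-injective) ∣-z∣≤v
  in (½ , w₊) ∷ (½ , w₋) ∷ [] ,
     (ℚₚ.nonNegative⁻¹ ½ , w₊≢v , w₊∈fiber) ∷ (ℚₚ.nonNegative⁻¹ ½ , w₋≢v , w₋∈fiber) ∷ [] ,
     refl ,
     λ i → begin
       ½ * ℕ→ℚ (w₊ i) + (½ * ℕ→ℚ (w₋ i) + 0ℚ)
         ≡⟨ cong₂ (λ a b → ½ * a + (½ * b + 0ℚ))
                  (w₊≡v+z i) (trans (w₋≡v-z i) (cong (ℕ→ℚ (v i) +_) (ℤ→ℚ-neg (z i)))) ⟩
       ½ * (ℕ→ℚ (v i) + ℤ→ℚ (z i)) + (½ * (ℕ→ℚ (v i) - ℤ→ℚ (z i)) + 0ℚ)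
         ≡⟨ half-sum-and-difference (ℕ→ℚ (v i)) (ℤ→ℚ (z i)) ⟩
       ℕ→ℚ (v i) ∎
  where
  open ≡-Reasoning
  ∣-z∣≤v : ∀ i → ℤ.∣ ℤ.- z i ∣ ℕ.≤ v i
  ∣-z∣≤v i = subst (ℕ._≤ v i) (sym (ℤₚ.∣-i∣≡∣i∣ (z i))) (∣z∣≤v i)
  half-sum-and-difference : ∀ a d → ½ * (a + d) + (½ * (a - d) + 0ℚ) ≡ a
  half-sum-and-difference a d =
    trans (solve 3 (λ h a d → h :* (a :+ d) :+ (h :* (a :- d) :+ con 0ℚ) := (h :+ h) :* a) refl ½ a d)
          (ℚₚ.*-identityˡ a)
    where open +-*-Solver

upper-bound : ∀ {n} (f : Fin n → ℕ) → ∃ λ K → ∀ i → f i ℕ.≤ K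
upper-bound {zero}  f = 0 , λ ()
upper-bound {suc n} f with upper-bound (f ∘ suc)
... | K , f∘suc≤K = f zero ℕ.⊔ K , λ { zero → ℕₚ.m≤m⊔n (f zero) K ; (suc i) → ℕₚ.m≤n⇒m≤o⊔n (f zero) (f∘suc≤K i) }

-- For k > max ∣zᵢ∣ the exponent k u dominates ∣z∣, since z vanishes wherever u does.
lattice-vector⇒InRadical : ∀ {n m} (B : Mat n m) {u : Exp n} {z} → InLattice B z → (∃ λ i → z i ≢ ℤ.+ 0) →
                           (∀ i → u i ≡ 0 → z i ≡ ℤ.+ 0) → InRadical (InVertexIdeal B) u
lattice-vector⇒InRadical B {u} {z} z∈𝓛 z≢0 z⊆supp-u =
  suc K , ℕ.s≤s ℕ.z≤n , v , midpoint⇒NotVertex B z∈𝓛 z≢0 ∣z∣≤v , λ _ → ℕₚ.≤-refl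
  where
  K : ℕ
  K = proj₁ (upper-bound (λ i → ℤ.∣ z i ∣))
  v : Exp _
  v i = suc K ℕ.* u i
  ∣z∣≤v : ∀ i → ℤ.∣ z i ∣ ℕ.≤ v i
  ∣z∣≤v i with u i in uᵢ≡
  ... | zero  = subst (ℕ._≤ suc K ℕ.* 0) (cong ℤ.∣_∣ (sym (z⊆supp-u i uᵢ≡))) ℕ.z≤n
  ... | suc t = ℕₚ.≤-trans (proj₂ (upper-bound (λ i → ℤ.∣ z i ∣)) i)
                           (ℕₚ.≤-trans (ℕₚ.n≤1+n K) (ℕₚ.m≤m*n (suc K) (suc t)))

-- Vertices from independent rows

IsListSum : ∀ {A : Set} → (A → ℚ) → (List A → ℚ) → Set
IsListSum f S = S [] ≡ 0ℚ × ∀ x xs → S (x ∷ xs) ≡ f x + S xs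

module _ {A : Set} (f : A → ℚ) {S : List A → ℚ} (isSum : IsListSum f S) where

  private
    S-[] : S [] ≡ 0ℚ
    S-[] = proj₁ isSum
    S-∷ : ∀ x xs → S (x ∷ xs) ≡ f x + S xs
    S-∷ = proj₂ isSum

  listSum-nonNeg : ∀ {xs} → All (λ x → 0ℚ ≤ f x) xs → 0ℚ ≤ S xs
  listSum-nonNeg {[]}     []            = ℚₚ.≤-reflexive (sym S-[])
  listSum-nonNeg {x ∷ xs} (0≤fx ∷ 0≤fs) = subst (0ℚ ≤_) (sym (S-∷ x xs)) (ℚₚ.+-mono-≤ 0≤fx (listSum-nonNeg 0≤fs))

  listSum-term≤ : ∀ {xs y} → All (λ x → 0ℚ ≤ f x) xs → y ∈ₗ xs → f y ≤ S xs
  listSum-term≤ {x ∷ xs} (_ ∷ 0≤fs) (here refl) = begin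
    f x          ≡⟨ ℚₚ.+-identityʳ (f x) ⟨
    f x + 0ℚ     ≤⟨ ℚₚ.+-monoʳ-≤ (f x) (listSum-nonNeg 0≤fs) ⟩
    f x + S xs   ≡⟨ S-∷ x xs ⟨
    S (x ∷ xs)   ∎
    where open ℚₚ.≤-Reasoning
  listSum-term≤ {x ∷ xs} {y} (0≤fx ∷ 0≤fs) (there y∈xs) = begin
    f y          ≤⟨ listSum-term≤ 0≤fs y∈xs ⟩
    S xs         ≡⟨ ℚₚ.+-identityˡ (S xs) ⟨
    0ℚ + S xs    ≤⟨ ℚₚ.+-monoˡ-≤ (S xs) 0≤fx ⟩
    f x + S xs   ≡⟨ S-∷ x xs ⟨
    S (x ∷ xs)   ∎
    where open ℚₚ.≤-Reasoning

  listSum-nonzero-term : ∀ xs → S xs ≢ 0ℚ → ∃ λ x → x ∈ₗ xs × f x ≢ 0ℚ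
  listSum-nonzero-term []       S≢0 = ⊥-elim (S≢0 S-[])
  listSum-nonzero-term (x ∷ xs) S≢0 with f x ℚₚ.≟ 0ℚ
  ... | no fx≢0 = x , here refl , fx≢0
  ... | yes fx≡0 =
    let (y , y∈xs , fy≢0) = listSum-nonzero-term xs λ Sxs≡0 → S≢0 (trans (S-∷ x xs) (cong₂ _+_ fx≡0 Sxs≡0))
    in y , there y∈xs , fy≢0

-- The sums in NotVertex are computed by a function local to its definition, which
-- cannot be named here; NotVertex B v is NotVertexWithSums B v S₁ S₂ for functions
-- S₁, S₂ that satisfy their defining equations by refl.
NotVertexWithSums : ∀ {n m} → Mat n m → Exp n → (List (ℚ × Exp n) → ℚ) → (Fin n → List (ℚ × Exp n) → ℚ) → Set
NotVertexWithSums {n} B v S₁ S₂ =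
  Σ (List (ℚ × Exp n)) λ ps →
    All (λ p → (0ℚ ≤ proj₁ p) × ¬ (∀ i → proj₂ p i ≡ v i) × InFiber B v (proj₂ p)) ps ×
    (S₁ ps ≡ 1ℚ) × (∀ i → S₂ i ps ≡ ℕ→ℚ (v i))

-- A point w of positive weight t satisfies t wᵢ ≤ vᵢ, so it vanishes where v does.
NotVertexWithSums⇒fiber-point-within-support :
  ∀ {n m} (B : Mat n m) {v : Exp n} {S₁ S₂} → IsListSum proj₁ S₁ →
  (∀ i → IsListSum (λ p → proj₁ p * ℕ→ℚ (proj₂ p i)) (S₂ i)) → NotVertexWithSums B v S₁ S₂ →
  ∃ λ w → ¬ (∀ i → w i ≡ v i) × InFiber B v w × (∀ i → v i ≡ 0 → w i ≡ 0)
NotVertexWithSums⇒fiber-point-within-support B {v} S₁-sum S₂-sum (ps , conditions , Σt≡1 , Σtw≡v)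
  with listSum-nonzero-term proj₁ S₁-sum ps (ℚₚ.1≢0 ∘ trans (sym Σt≡1))
... | (t , w) , tw∈ps , t≢0 with All.lookup conditions tw∈ps
... | _ , w≢v , w∈fiber = w , w≢v , w∈fiber , w⊆supp-v
  where
  weighted-nonNeg : ∀ i → All (λ p → 0ℚ ≤ proj₁ p * ℕ→ℚ (proj₂ p i)) ps
  weighted-nonNeg i = All.map (λ {p} (0≤tₚ , _) → p*ℕ→ℚ-nonNeg 0≤tₚ (proj₂ p i)) conditions
  w⊆supp-v : ∀ i → v i ≡ 0 → w i ≡ 0
  w⊆supp-v i vᵢ≡0 = ℕ→ℚ-injective (p*q≡0⇒p≡0 (ℕ→ℚ (w i)) t t≢0 (trans (ℚₚ.*-comm (ℕ→ℚ (w i)) t) twᵢ≡0))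
    where
    twᵢ≤vᵢ : t * ℕ→ℚ (w i) ≤ ℕ→ℚ (v i)
    twᵢ≤vᵢ = subst (t * ℕ→ℚ (w i) ≤_) (Σtw≡v i)
               (listSum-term≤ (λ p → proj₁ p * ℕ→ℚ (proj₂ p i)) (S₂-sum i) (weighted-nonNeg i) tw∈ps)
    twᵢ≡0 : t * ℕ→ℚ (w i) ≡ 0ℚ
    twᵢ≡0 = ℚₚ.≤-antisym (subst (λ k → t * ℕ→ℚ (w i) ≤ ℕ→ℚ k) vᵢ≡0 twᵢ≤vᵢ) (All.lookup (weighted-nonNeg i) tw∈ps)

NotVertex⇒fiber-point-within-support : ∀ {n m} (B : Mat n m) {v : Exp n} → NotVertex B v →
  ∃ λ w → ¬ (∀ i → w i ≡ v i) × InFiber B v w × (∀ i → v i ≡ 0 → w i ≡ 0)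
NotVertex⇒fiber-point-within-support B =
  NotVertexWithSums⇒fiber-point-within-support B (refl , λ _ _ → refl) (λ _ → refl , λ _ _ → refl)

fiber-point-determined-by-independent-rows : ∀ {n m} (B : Mat n m) {σ} → ∣ σ ∣ ≡ m → RowsIndependent B σ →
  ∀ {v w} → InFiber B v w → (∀ i → i ∈ σ → w i ≡ v i) → ∀ i → w i ≡ v i
fiber-point-determined-by-independent-rows {m = m} B {σ} ∣σ∣≡m ind {v} {w} (c , v-w≡Bc) w≡v-on-σ i =
  sym (ℤₚ.+-injective (ℤₚ.i-j≡0⇒i≡j (ℤ.+ v i) (ℤ.+ w i) (trans (v-w≡Bc i) (Bc≡0 i))))
  where
  Bc≡0-on-σ : ∀ i → i ∈ σ → (toℚ B *ᵥ (ℤ→ℚ ∘ c)) i ≡ 0ℚ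
  Bc≡0-on-σ i i∈σ = begin
    (toℚ B *ᵥ (ℤ→ℚ ∘ c)) i              ≡⟨ ℤ→ℚ-*ᵥ B c i ⟨
    ℤ→ℚ (Σℤ m (λ j → B i j ℤ.* c j))    ≡⟨ cong ℤ→ℚ (v-w≡Bc i) ⟨
    ℤ→ℚ (ℤ.+ v i ℤ.- ℤ.+ w i)           ≡⟨ cong (λ k → ℤ→ℚ (ℤ.+ v i ℤ.- ℤ.+ k)) (w≡v-on-σ i i∈σ) ⟩
    ℤ→ℚ (ℤ.+ v i ℤ.- ℤ.+ v i)           ≡⟨ cong ℤ→ℚ (ℤₚ.+-inverseʳ (ℤ.+ v i)) ⟩
    0ℚ                                  ∎
    where open ≡-Reasoning
  c≡0 : ∀ j → ℤ→ℚ (c j) ≡ 0ℚ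
  c≡0 = square-IndependentRows⇒*ᵥ-injective (toℚ B) ∣σ∣≡m (Equivalence.to (RowsIndependent⇔IndependentRows B σ) ind)
                                             (ℤ→ℚ ∘ c) Bc≡0-on-σ
  Bc≡0 : ∀ i → Σℤ m (λ j → B i j ℤ.* c j) ≡ ℤ.+ 0
  Bc≡0 i = ℤ→ℚ-injective (trans (ℤ→ℚ-*ᵥ B c i) (*ᵥ-zeroʳ (toℚ B) c≡0 i))

InPrime? : ∀ {n} (σ : Subset n) (u : Exp n) → Dec (InPrime σ u)
InPrime? σ u = Finₚ.any? (λ i → (i ∈? σ) ×-dec (1 ℕ.≤? u i))

¬InPrime⇒vanishes : ∀ {n} {σ : Subset n} {u : Exp n} → ¬ InPrime σ u → ∀ i → i ∈ σ → u i ≡ 0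
¬InPrime⇒vanishes ¬prime i i∈σ = ℕₚ.n≤0⇒n≡0 (ℕₚ.≮⇒≥ λ 0<uᵢ → ¬prime (i , i∈σ , 0<uᵢ))

InRadical⇒InPrime : ∀ {n m} (B : Mat n m) {u : Exp n} {σ} → InRadical (InVertexIdeal B) u →
                    ∣ σ ∣ ≡ m → RowsIndependent B σ → InPrime σ u
InRadical⇒InPrime B {u} {σ} (k , _ , v , v-notVertex , v≤ku) ∣σ∣≡m ind =
  decidable-stable (InPrime? σ u) λ ¬prime →
    let (w , w≢v , w∈fiber , w⊆supp-v) = NotVertex⇒fiber-point-within-support B v-notVertex
        v≡0-on-σ : ∀ i → i ∈ σ → v i ≡ 0
        v≡0-on-σ i i∈σ = ℕₚ.n≤0⇒n≡0 (subst (v i ℕ.≤_) (trans (cong (k ℕ.*_) (¬InPrime⇒vanishes ¬prime i i∈σ))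
                                                           (ℕₚ.*-zeroʳ k))
                                                    (v≤ku i))
    in w≢v (fiber-point-determined-by-independent-rows B ∣σ∣≡m ind w∈fiber
             λ i i∈σ → trans (w⊆supp-v i (v≡0-on-σ i i∈σ)) (sym (v≡0-on-σ i i∈σ)))

theorem2p10 : (n m : ℕ) (B : Mat n m) → ColumnsIndependent B →
    (u : Exp n) →
    InRadical (InVertexIdeal B) u ⇔
      ((σ : Subset n) → ∣ σ ∣ ≡ m → RowsIndependent B σ → InPrime σ u)
theorem2p10 n m B independent u = mk⇔ (λ rad σ ∣σ∣≡m ind → InRadical⇒InPrime B rad ∣σ∣≡m ind) InPrimes⇒InRadical
  where
  InPrimes⇒InRadical : ((σ : Subset n) → ∣ σ ∣ ≡ m → RowsIndependent B σ → InPrime σ u) →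
                       InRadical (InVertexIdeal B) u
  InPrimes⇒InRadical inPrimes with kernel-or-independent-rows-within (λ i → u i ℕₚ.≟ 0) (toℚ B)
  ... | inj₂ (σ , ∣σ∣≡m , ind , u≡0-on-σ) =
    let (i , i∈σ , 0<uᵢ) = inPrimes σ ∣σ∣≡m (Equivalence.from (RowsIndependent⇔IndependentRows B σ) ind)
    in ⊥-elim (ℕₚ.<⇒≢ 0<uᵢ (sym (u≡0-on-σ i i∈σ)))
  ... | inj₁ (c , c≢0 , Bc≡0-where-u≡0) =
    let (z , z∈𝓛 , z≢0 , z≡0-where-Bc≡0) = nonzero-lattice-multiple B independent c c≢0
    in lattice-vector⇒InRadical B z∈𝓛 z≢0 λ i uᵢ≡0 → z≡0-where-Bc≡0 i (Bc≡0-where-u≡0 i uᵢ≡0)
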